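{- $sh(\mathcal{C}, \mathtt{XYX})$ is determined completely by $sh(\mathcal{C}, \mathtt{XXY})$.
   Context: Let $\mathcal{B}=\{\mathtt{A},\mathtt{C},\mathtt{G},\mathtt{T}\}$ be the genetic alphabet, and let $c\colon\mathcal{B}\to\mathcal{B}$ be the complementarity map $c(\mathtt{A})=\mathtt{T}$, $c(\mathtt{T})=\mathtt{A}$, $c(\mathtt{C})=\mathtt{G}$, $c(\mathtt{G})=\mathtt{C}$. For a codon $w=N_1N_2N_3\in\mathcal{B}^3$ its reverse complement is $\overleftarrow{c}(w)=c(N_3)c(N_2)c(N_1)$, and $\alpha(N_1N_2N_3)=N_3N_1N_2$ is the cyclic shift. A set of 3-letter words is a circular code if any concatenation of its words written on a circle can be decomposed into a concatenation of its words in a unique way. Here $\mathcal{C}$ is a maximal $C^3$ circular code: a circular code with $|\mathcal{C}|=20$, $\overleftarrow{c}(\mathcal{C})=\mathcal{C}$, and $\alpha(\mathcal{C})$ (hence also $\alpha^2(\mathcal{C})$) circular. A codon has shape $\mathtt{XXY}$, $\mathtt{XYY}$, $\mathtt{XYX}$ or $\mathtt{XYZ}$ if it is obtained from this pattern by substituting bases for $\mathtt{X},\mathtt{Y},\mathtt{Z}$ (distinct letters standing for distinct bases), and $sh(\mathcal{C},S)$ denotes the set of codons of $\mathcal{C}$ of shape $S$. -}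

module Defs where

open import Data.Bool using (Bool; true; false)
open import Data.Nat using (ℕ)
open import Data.List using (List; []; _∷_; _++_; concatMap; length; filter; map; concat)
open import Data.List.Relation.Unary.All using (All)
open import Data.Product using (_×_; _,_)
open import Relation.Binary.PropositionalEquality using (_≡_; _≢_)
open import Relation.Nullary using (¬_)

data Base : Set where
  A C G T : Base

comp : Base → Base
comp A = T
comp T = A
comp C = G
comp G = C

data Codon : Set where
  cod : Base → Base → Base → Codon

allBases : List Base
allBases = A ∷ C ∷ G ∷ T ∷ []

allCodons : List Codon
allCodons = concatMap (λ a → concatMap (λ b → map (λ c → cod a b c) allBases) allBases) allBases

revComp : Codon → Codon
revComp (cod a b c) = cod (comp c) (comp b) (comp a)

α : Codon → Codon
α (cod a b c) = cod c a b

CodonSet : Set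
CodonSet = Codon → Bool

_∈C_ : Codon → CodonSet → Set
w ∈C X = X w ≡ true

-- image of a set under α : w ∈ α(X) iff α⁻¹(w) = α(α(w)) ∈ X
αImage : CodonSet → CodonSet
αImage X w = X (α (α w))

card : CodonSet → ℕ
card X = length (filter (λ w → Data.Bool._≟_ (X w) true) allCodons)

letters : Codon → List Base
letters (cod a b c) = a ∷ b ∷ c ∷ []

word : List Codon → List Base
word ws = concat (map letters ws)

-- Circular code (Berstel–Perrin): for all n,m ≥ 1, x₁..xₙ, y₁..yₘ ∈ X,
-- p ∈ B*, s ∈ B⁺: if  x₁ = p s  and  s x₂⋯xₙ p = y₁⋯yₘ
-- then n = m, p = ε and xᵢ = yᵢ for all i.
-- (Equivalently: every concatenation of words of X written on a circle has
-- a unique decomposition into words of X.)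
IsCircular : CodonSet → Set
IsCircular X =
  ∀ (x : Codon) (xs : List Codon) (y : Codon) (ys : List Codon)
    (p s : List Base) →
  All (_∈C X) (x ∷ xs) → All (_∈C X) (y ∷ ys) →
  s ≢ [] →
  letters x ≡ p ++ s →
  s ++ word xs ++ p ≡ word (y ∷ ys) →
  (p ≡ []) × (x ∷ xs ≡ y ∷ ys)

IsMaxC3 : CodonSet → Set
IsMaxC3 X =
  IsCircular X ×
  (card X ≡ 20) ×
  (∀ w → X (revComp w) ≡ X w) ×
  IsCircular (αImage X) ×
  IsCircular (αImage (αImage X))

ShapeXXY : Codon → Set
ShapeXXY (cod a b c) = (a ≡ b) × (b ≢ c)

ShapeXYY : Codon → Set
ShapeXYY (cod a b c) = (a ≢ b) × (b ≡ c)

ShapeXYX : Codon → Set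
ShapeXYX (cod a b c) = (a ≡ c) × (a ≢ b)

ShapeXYZ : Codon → Set
ShapeXYZ (cod a b c) = (a ≢ b) × (b ≢ c) × (a ≢ c)

-- A circular code never contains a codon together with its cyclic shift, so it contains no
-- periodic codon and at most one codon from each of the 20 classes {w, α w, α² w} into which
-- the 60 non-periodic codons fall; a code of 20 codons therefore meets every class. The class
-- of xyx is {xyx, xxy, yxx}. If xyx ∈ 𝒞 then xxy, yxx ∉ 𝒞; since xxy has shape XXY and yxx is
-- the reverse complement of the XXY codon c(x)c(x)c(y), a second self-complementary code 𝒞′
-- with the same XXY codons misses xxy and yxx too, so it must contain xyx.
module Submission where

open import Defs
open import Data.Bool using (true; _≟_)
open import Data.Bool.Properties using (⇔→≡)
open import Data.Fin using (#_)
open import Level using (0ℓ)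
open import Data.List using (List; []; _∷_; _++_; concat; concatMap; map; filter; length)
open import Data.List.Membership.Propositional using (_∈_)
open import Data.List.Membership.Propositional.Properties using (∈-lookup)
open import Data.List.Properties using (filter-++; filter-none; length-filter; length-++; length-map)
open import Data.List.Relation.Binary.Permutation.Propositional using (_↭_; ↭-sym; ↭-trans)
open import Data.List.Relation.Binary.Permutation.Propositional.Properties using (↭-length; filter-↭)
open import Data.List.Relation.Unary.All using (All; []; _∷_; universal)
open import Data.List.Relation.Unary.All.Properties as All using ()
open import Data.List.Relation.Unary.Any as Any using (Any; here; there)
import Data.List.Relation.Unary.Any.Properties as Anyₚ
import Data.List.Sort.InsertionSort.Base as InsertionSort
import Data.List.Sort.InsertionSort.Properties as InsertionSortₚ
open import Data.Nat using (ℕ; suc; _+_; _*_; _≤_; _<_; z≤n; s≤s)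
open import Data.Nat.Properties using (≤-decTotalOrder; +-mono-≤; +-mono-≤-<; n<1+n; <-irrefl; +-identityʳ; ≤-reflexive; module ≤-Reasoning)
open import Data.Product using (_,_; proj₁)
open import Function using (_∘_; mk⇔)
import Relation.Binary.Construct.On as On
open import Relation.Binary.Bundles using (DecTotalOrder)
open import Relation.Binary.PropositionalEquality using (_≡_; _≢_; refl; sym; trans; cong; module ≡-Reasoning)
open import Relation.Nullary using (¬_; yes; no; contradiction)
open import Relation.Nullary.Decidable using (decidable-stable)
open import Relation.Unary using (Pred; Decidable)

module _ {a p} {A : Set a} {P : Pred A p} (P? : Decidable P) where

  count : List A → ℕ
  count xs = length (filter P? xs)

  count-↭ : ∀ {xs ys} → xs ↭ ys → count xs ≡ count ys
  count-↭ = ↭-length ∘ filter-↭ P?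

  count-++ : ∀ xs ys → count (xs ++ ys) ≡ count xs + count ys
  count-++ xs ys = trans (cong length (filter-++ P? xs ys)) (length-++ (filter P? xs))

  count-none : ∀ {xs} → All (¬_ ∘ P) xs → count xs ≡ 0
  count-none = cong length ∘ filter-none P?

  count-∷-≤1 : ∀ {x xs} → (P x → All (¬_ ∘ P) xs) → count xs ≤ 1 → count (x ∷ xs) ≤ 1
  count-∷-≤1 {x} {xs} exclusive xs≤1 with P? x
  ... | yes px = s≤s (≤-reflexive (count-none (exclusive px)))
  ... | no _   = xs≤1

  count-concat-≤ : ∀ {bs} → All (λ b → count b ≤ 1) bs → count (concat bs) ≤ length bs
  count-concat-≤ [] = z≤n
  count-concat-≤ {b ∷ bs} (b≤1 ∷ bs≤1) = begin
    count (b ++ concat bs)       ≡⟨ count-++ b (concat bs) ⟩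
    count b + count (concat bs)  ≤⟨ +-mono-≤ b≤1 (count-concat-≤ bs≤1) ⟩
    suc (length bs)              ∎
    where open ≤-Reasoning

  count-concat-< : ∀ {bs} → All (λ b → count b ≤ 1) bs → Any (λ b → count b ≡ 0) bs →
                   count (concat bs) < length bs
  count-concat-< {b ∷ bs} (_ ∷ bs≤1) (here b≡0) = begin-strict
    count (b ++ concat bs)       ≡⟨ count-++ b (concat bs) ⟩
    count b + count (concat bs)  ≡⟨ cong (_+ count (concat bs)) b≡0 ⟩
    count (concat bs)            ≤⟨ count-concat-≤ bs≤1 ⟩
    length bs                    <⟨ n<1+n (length bs) ⟩
    suc (length bs)              ∎
    where open ≤-Reasoning
  count-concat-< {b ∷ bs} (b≤1 ∷ bs≤1) (there some≡0) = begin-strict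
    count (b ++ concat bs)       ≡⟨ count-++ b (concat bs) ⟩
    count b + count (concat bs)  <⟨ +-mono-≤-< b≤1 (count-concat-< bs≤1 some≡0) ⟩
    suc (length bs)              ∎
    where open ≤-Reasoning

comp-involutive : ∀ a → comp (comp a) ≡ a
comp-involutive A = refl
comp-involutive C = refl
comp-involutive G = refl
comp-involutive T = refl

comp-injective : ∀ {a b} → comp a ≡ comp b → a ≡ b
comp-injective {a} {b} eq = trans (sym (comp-involutive a)) (trans (cong comp eq) (comp-involutive b))

inC? : (X : CodonSet) → Decidable (_∈C X)
inC? X w = X w ≟ true

conjugates : Codon → List Codon
conjugates w = w ∷ α w ∷ α (α w) ∷ []

classRepresentatives : List Codon
classRepresentatives =
  cod A C A ∷ cod A G A ∷ cod A T A ∷ cod C A C ∷ cod C G C ∷ cod C T C ∷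
  cod G A G ∷ cod G C G ∷ cod G T G ∷ cod T A T ∷ cod T C T ∷ cod T G T ∷
  cod A C G ∷ cod A C T ∷ cod A G C ∷ cod A G T ∷ cod A T C ∷ cod A T G ∷ cod C G T ∷ cod C T G ∷ []

classCodons : List Codon
classCodons = concatMap conjugates classRepresentatives

periodicCodons : List Codon
periodicCodons = map (λ a → cod a a a) allBases

xyx∈classRepresentatives : ∀ {a b} → a ≢ b → cod a b a ∈ classRepresentatives
xyx∈classRepresentatives {A} {A} a≢b = contradiction refl a≢b
xyx∈classRepresentatives {A} {C} _ = ∈-lookup (# 0)
xyx∈classRepresentatives {A} {G} _ = ∈-lookup (# 1)
xyx∈classRepresentatives {A} {T} _ = ∈-lookup (# 2)
xyx∈classRepresentatives {C} {A} _ = ∈-lookup (# 3)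
xyx∈classRepresentatives {C} {C} a≢b = contradiction refl a≢b
xyx∈classRepresentatives {C} {G} _ = ∈-lookup (# 4)
xyx∈classRepresentatives {C} {T} _ = ∈-lookup (# 5)
xyx∈classRepresentatives {G} {A} _ = ∈-lookup (# 6)
xyx∈classRepresentatives {G} {C} _ = ∈-lookup (# 7)
xyx∈classRepresentatives {G} {G} a≢b = contradiction refl a≢b
xyx∈classRepresentatives {G} {T} _ = ∈-lookup (# 8)
xyx∈classRepresentatives {T} {A} _ = ∈-lookup (# 9)
xyx∈classRepresentatives {T} {C} _ = ∈-lookup (# 10)
xyx∈classRepresentatives {T} {G} _ = ∈-lookup (# 11)
xyx∈classRepresentatives {T} {T} a≢b = contradiction refl a≢b

baseIndex : Base → ℕ
baseIndex A = 0
baseIndex C = 1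
baseIndex G = 2
baseIndex T = 3

codonIndex : Codon → ℕ
codonIndex (cod a b c) = 16 * baseIndex a + 4 * baseIndex b + baseIndex c

codonOrder : DecTotalOrder 0ℓ 0ℓ 0ℓ
codonOrder = On.decTotalOrder ≤-decTotalOrder codonIndex

open InsertionSort codonOrder using (sort)
open InsertionSortₚ codonOrder using (sort-↭)

-- Both sides sort to the same list, which the type checker verifies by evaluation.
allCodons-↭ : allCodons ↭ classCodons ++ periodicCodons
allCodons-↭ = ↭-trans (↭-sym (sort-↭ allCodons)) (sort-↭ (classCodons ++ periodicCodons))

module _ {X : CodonSet} (circular : IsCircular X) where

  -- The circular word c a b factorises both as (a b)·c and as c·(a b).
  ∈⇒α∉ : ∀ {w} → w ∈C X → ¬ α w ∈C X
  ∈⇒α∉ {cod a b c} w∈X αw∈X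
    with () ← proj₁ (circular (cod a b c) [] (cod c a b) [] (a ∷ b ∷ []) (c ∷ [])
                              (w∈X ∷ []) (αw∈X ∷ []) (λ ()) refl refl)

  periodic∉ : ∀ a → ¬ cod a a a ∈C X
  periodic∉ a aaa∈X = ∈⇒α∉ aaa∈X aaa∈X

  count-conjugates-≤1 : ∀ w → count (inC? X) (conjugates w) ≤ 1
  count-conjugates-≤1 (cod a b c) =
    count-∷-≤1 (inC? X) (λ w∈X → ∈⇒α∉ w∈X ∷ (λ α²w∈X → ∈⇒α∉ α²w∈X w∈X) ∷ [])
      (count-∷-≤1 (inC? X) (λ αw∈X → ∈⇒α∉ αw∈X ∷ [])
        (length-filter (inC? X) (cod b c a ∷ [])))

  card<20 : Any (λ r → count (inC? X) (conjugates r) ≡ 0) classRepresentatives → card X < 20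
  card<20 someClassMissed = begin-strict
    card X                                              ≡⟨ count-↭ (inC? X) allCodons-↭ ⟩
    count (inC? X) (classCodons ++ periodicCodons)      ≡⟨ count-++ (inC? X) classCodons periodicCodons ⟩
    count (inC? X) classCodons + count (inC? X) periodicCodons
                                                        ≡⟨ cong (count (inC? X) classCodons +_) noPeriodic ⟩
    count (inC? X) classCodons + 0                      ≡⟨ +-identityʳ _ ⟩
    count (inC? X) classCodons                          <⟨ count-concat-< (inC? X) classesAtMostOne someClassMissed′ ⟩
    length (map conjugates classRepresentatives)        ≡⟨ length-map conjugates classRepresentatives ⟩
    20                                                  ∎
    where
    open ≤-Reasoning
    noPeriodic : count (inC? X) periodicCodons ≡ 0
    noPeriodic = count-none (inC? X) (All.map⁺ (universal periodic∉ allBases))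
    classesAtMostOne : All (λ b → count (inC? X) b ≤ 1) (map conjugates classRepresentatives)
    classesAtMostOne = All.map⁺ {f = conjugates} (universal count-conjugates-≤1 classRepresentatives)
    someClassMissed′ : Any (λ b → count (inC? X) b ≡ 0) (map conjugates classRepresentatives)
    someClassMissed′ = Anyₚ.map⁺ {f = conjugates} someClassMissed

ClosedUnderRevComp : CodonSet → Set
ClosedUnderRevComp X = ∀ w → X (revComp w) ≡ X w

xyx-∈-transfer : ∀ {X Y} → IsCircular X → ClosedUnderRevComp X →
                 IsCircular Y → ClosedUnderRevComp Y → card Y ≡ 20 →
                 (∀ w → ShapeXXY w → X w ≡ Y w) →
                 ∀ {a b} → a ≢ b → cod a b a ∈C X → cod a b a ∈C Y
xyx-∈-transfer {X} {Y} circX revX circY revY cardY agree {a} {b} a≢b aba∈X =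
  decidable-stable (inC? Y (cod a b a)) λ aba∉Y →
    <-irrefl cardY (card<20 circY (Any.map (λ { refl → classMissed aba∉Y })
                                                 (xyx∈classRepresentatives a≢b)))
  where
  aab∉Y : ¬ cod a a b ∈C Y
  aab∉Y aab∈Y = ∈⇒α∉ circX aba∈X (trans (agree (cod a a b) (refl , a≢b)) aab∈Y)

  baa∉Y : ¬ cod b a a ∈C Y
  baa∉Y baa∈Y = ∈⇒α∉ circX baa∈X aba∈X
    where
    open ≡-Reasoning
    baa∈X : cod b a a ∈C X
    baa∈X = begin
      X (cod b a a)                        ≡⟨ revX (cod b a a) ⟨
      X (cod (comp a) (comp a) (comp b))   ≡⟨ agree _ (refl , a≢b ∘ comp-injective) ⟩
      Y (cod (comp a) (comp a) (comp b))   ≡⟨ revY (cod b a a) ⟩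
      Y (cod b a a)                        ≡⟨ baa∈Y ⟩
      true                                 ∎

  classMissed : ¬ cod a b a ∈C Y → count (inC? Y) (conjugates (cod a b a)) ≡ 0
  classMissed aba∉Y = count-none (inC? Y) (aba∉Y ∷ aab∉Y ∷ baa∉Y ∷ [])

mainTheorem5 : (X Y : CodonSet) → IsMaxC3 X → IsMaxC3 Y →
    (∀ w → ShapeXXY w → X w ≡ Y w) →
    (∀ w → ShapeXYX w → X w ≡ Y w)
mainTheorem5 X Y (circX , cardX , revX , _) (circY , cardY , revY , _) agree (cod a b .a) (refl , a≢b) =
  ⇔→≡ (mk⇔ (xyx-∈-transfer circX revX circY revY cardY agree a≢b)
           (xyx-∈-transfer circY revY circX revX cardX (λ w s → sym (agree w s)) a≢b))
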